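{- Let $k \geq 1$ and let $C_n^k$ be a non-complete power of a cycle (i.e. $n \geq 2k+2$) with $n \geq 2k^2$. Then $C_n^k$ has biclique-chromatic number $2$.
   Context: For $k \geq 1$, the power of a cycle $C_n^k$ is the simple graph with vertex set $\{v_0,\dots,v_{n-1}\}$ in which $v_i v_j$ ($i\neq j$) is an edge if and only if $\min\{(j-i) \bmod n, (i-j) \bmod n\} \leq k$. A biclique of a graph is a maximal (under inclusion) set of vertices inducing a complete bipartite subgraph with at least one edge. A biclique-colouring is an assignment of colours to the vertices such that no biclique is monochromatic; the biclique-chromatic number is the least $c$ such that a biclique-colouring with at most $c$ colours exists. -}

module Defs where

open import Data.Nat using (ℕ; zero; suc; _+_; _∸_; _≤_; _<_; NonZero)
open import Data.Nat.DivMod using (_%_)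
open import Data.Nat as ℕ using (_⊓_)
open import Data.Fin using (Fin; toℕ)
open import Data.Fin.Subset using (Subset; _∈_; _∉_; _⊆_; _⊂_)
open import Data.Product using (Σ; ∃; ∃-syntax; _×_; _,_)
open import Relation.Nullary using (¬_)
open import Relation.Binary.PropositionalEquality using (_≡_; _≢_)
open import Data.Sum using (_⊎_)

record Graph (n : ℕ) : Set₁ where
  field
    Adj : Fin n → Fin n → Set

open Graph public

-- Power of a cycle C_n^k on vertices v_0 … v_{n-1} (v_i ↔ i : Fin n):
-- v_i v_j is an edge iff i ≠ j and min((j-i) mod n, (i-j) mod n) ≤ k.
-- (j - i) mod n is computed on naturals as (n + j ∸ i) % n (valid as i < n).
cycleDist : (n : ℕ) → .{{NonZero n}} → Fin n → Fin n → ℕ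
cycleDist n i j = ((n + toℕ j ∸ toℕ i) % n) ⊓ ((n + toℕ i ∸ toℕ j) % n)

CyclePower : (n : ℕ) → .{{NonZero n}} → (k : ℕ) → Graph n
CyclePower n k .Adj i j = (i ≢ j) × (cycleDist n i j ≤ k)

InducesCompleteBipartite : ∀ {n} → Graph n → Subset n → Set
InducesCompleteBipartite {n} G S =
  Σ (Subset n) λ A → Σ (Subset n) λ B →
      (∀ v → v ∈ S → (v ∈ A) ⊎ (v ∈ B))
    × (∀ v → v ∈ A → v ∈ S) × (∀ v → v ∈ B → v ∈ S)
    × (∀ v → v ∈ A → v ∉ B)
    × (∃[ a ] a ∈ A) × (∃[ b ] b ∈ B)
    × (∀ u v → u ∈ A → v ∈ A → ¬ Adj G u v)
    × (∀ u v → u ∈ B → v ∈ B → ¬ Adj G u v)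
    × (∀ u v → u ∈ A → v ∈ B → Adj G u v)

IsBiclique : ∀ {n} → Graph n → Subset n → Set
IsBiclique G S = InducesCompleteBipartite G S
               × (∀ T → S ⊂ T → ¬ InducesCompleteBipartite G T)

Monochromatic : ∀ {n c} → (Fin n → Fin c) → Subset n → Set
Monochromatic {n} col S = ∀ u v → u ∈ S → v ∈ S → col u ≡ col v

IsBicliqueColouring : ∀ {n c} → Graph n → (Fin n → Fin c) → Set
IsBicliqueColouring G col = ∀ S → IsBiclique G S → ¬ Monochromatic col S

HasBicliqueColouring : ∀ {n} → Graph n → ℕ → Set
HasBicliqueColouring {n} G c = Σ (Fin n → Fin c) λ col → IsBicliqueColouring G col

BicliqueChromaticNumber : ∀ {n} → Graph n → ℕ → Set
BicliqueChromaticNumber G c =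
  HasBicliqueColouring G c × (∀ c′ → c′ < c → ¬ HasBicliqueColouring G c′)

-- A biclique of C_n^k either contains an induced path x – v – y or is a single edge ab, and
-- the latter is never maximal: a vertex adjacent to a but not to b extends it to a star. So a
-- 2-colouring without monochromatic induced P₃ is a biclique-colouring. Cut the cycle into an
-- even number m = 2⌊n/2k⌋ of consecutive arcs and colour them alternately; n ≥ 2k² makes
-- every arc span between k and k + 1 steps (km ≤ n ≤ (k + 1)m). In an induced x – v – y the
-- leaves lie on opposite sides of v (two neighbours on the same side are adjacent), so the
-- path makes two hops of length ≤ k totalling more than k: each hop crosses at most one arc
-- boundary, together they cross at least one, and the colours cannot all agree. One colour
-- does not suffice, since C_n^k has a biclique: a star on v_1 with leaves v_0 and v_{k+1},
-- or, for C_4^1, the whole graph.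
module Submission where

open import Defs
import Data.Nat as ℕ
open import Data.Nat
  using (ℕ; zero; suc; _+_; _*_; _∸_; _≤_; _<_; _≤?_; z≤n; s≤s; s≤s⁻¹; z<s; parity
        ; NonZero; >-nonZero; >-nonZero⁻¹; ≢-nonZero⁻¹)
open import Data.Nat.Properties hiding (_≟_)
open import Data.Nat.DivMod
open import Data.Nat.Divisibility using (divides)
open import Data.Nat.Tactic.RingSolver using (solve-∀)
open import Data.Parity.Base using (Parity; 0ℙ; 1ℙ)
import Data.Parity.Base as ℙ using (_+_)
import Data.Parity.Properties as ℙ
import Data.Fin as Fin
open import Data.Fin using (Fin; toℕ; _≟_)
open import Data.Fin.Properties using (toℕ-injective; toℕ<n; toℕ-fromℕ<; any?; all?; ¬Fin0)
open import Data.Fin.Subset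
  using (Subset; _∈_; _∉_; _⊆_; _⊂_; _∪_; ⁅_⁆; ⊤; inside; outside)
open import Data.Fin.Subset.Properties
  using (x∈⁅x⁆; x∈⁅y⁆⇒x≡y; p⊆p∪q; q⊆p∪q; x∈p∪q⁻; _∈?_; ∈⊤)
open import Data.Vec using ([]; _∷_)
open import Data.Product using (_×_; _,_; ∃-syntax; proj₁; proj₂; map₂)
open import Data.Sum as Sum using (_⊎_; inj₁; inj₂)
open import Data.Empty using (⊥; ⊥-elim)
open import Function using (_∘′_)
open import Relation.Nullary using (¬_; Dec; yes; no; ¬?)
open import Relation.Nullary.Decidable using (_×-dec_; _⊎-dec_; _→-dec_; from-yes)
open import Relation.Binary.PropositionalEquality

module Bicliques {n : ℕ} (G : Graph n)
  (adj-sym : ∀ {u v} → Adj G u v → Adj G v u)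
  (adj-irrefl : ∀ {u} → ¬ Adj G u u) where

  InducedP₃ : Fin n → Fin n → Fin n → Set
  InducedP₃ x v y = Adj G v x × Adj G v y × x ≢ y × ¬ Adj G x y

  PrivateNeighbour : Fin n → Fin n → Fin n → Set
  PrivateNeighbour c a b = Adj G a c × ¬ Adj G b c × c ≢ b

  EdgesHavePrivateNeighbours : Set
  EdgesHavePrivateNeighbours =
    ∀ {a b} → Adj G a b → ∃[ c ] (PrivateNeighbour c a b ⊎ PrivateNeighbour c b a)

  NoMonochromaticInducedP₃ : ∀ {c} → (Fin n → Fin c) → Set
  NoMonochromaticInducedP₃ col =
    ∀ {x v y} → InducedP₃ x v y → col x ≡ col v → col v ≡ col y → ⊥

  pair : Fin n → Fin n → Subset n
  pair x y = ⁅ x ⁆ ∪ ⁅ y ⁆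

  ∈-pair⁻ : ∀ {u x y} → u ∈ pair x y → u ≡ x ⊎ u ≡ y
  ∈-pair⁻ {x = x} {y} h = Sum.map (x∈⁅y⁆⇒x≡y x) (x∈⁅y⁆⇒x≡y y) (x∈p∪q⁻ ⁅ x ⁆ ⁅ y ⁆ h)

  x∈pair : ∀ x y → x ∈ pair x y
  x∈pair x y = p⊆p∪q ⁅ y ⁆ (x∈⁅x⁆ x)

  y∈pair : ∀ x y → y ∈ pair x y
  y∈pair x y = q⊆p∪q ⁅ x ⁆ ⁅ y ⁆ (x∈⁅x⁆ y)

  star : Fin n → Fin n → Fin n → Subset n
  star v x y = ⁅ v ⁆ ∪ pair x y

  centre∈star : ∀ v x y → v ∈ star v x y
  centre∈star v x y = p⊆p∪q (pair x y) (x∈⁅x⁆ v)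

  leaf∈star : ∀ {u} v x y → u ∈ pair x y → u ∈ star v x y
  leaf∈star v x y = q⊆p∪q ⁅ v ⁆ (pair x y)

  star-inducesCompleteBipartite : ∀ {x v y} → InducedP₃ x v y →
                                  InducesCompleteBipartite G (star v x y)
  star-inducesCompleteBipartite {x} {v} {y} (vx , vy , _ , x≁y) =
    ⁅ v ⁆ , pair x y , (λ _ → x∈p∪q⁻ ⁅ v ⁆ (pair x y)) , (λ _ → p⊆p∪q (pair x y))
    , (λ _ → leaf∈star v x y) , apart , (v , x∈⁅x⁆ v) , (x , x∈pair x y)
    , centre-independent , leaves-independent , centre-adjacent
    where
    centre-adjacent : ∀ u w → u ∈ ⁅ v ⁆ → w ∈ pair x y → Adj G u w
    centre-adjacent u w hu hw rewrite x∈⁅y⁆⇒x≡y v hu with ∈-pair⁻ hw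
    ... | inj₁ refl = vx
    ... | inj₂ refl = vy

    apart : ∀ u → u ∈ ⁅ v ⁆ → u ∉ pair x y
    apart u hu hp = adj-irrefl (centre-adjacent u u hu hp)

    centre-independent : ∀ u w → u ∈ ⁅ v ⁆ → w ∈ ⁅ v ⁆ → ¬ Adj G u w
    centre-independent u w hu hw rewrite x∈⁅y⁆⇒x≡y v hu | x∈⁅y⁆⇒x≡y v hw = adj-irrefl

    leaves-independent : ∀ u w → u ∈ pair x y → w ∈ pair x y → ¬ Adj G u w
    leaves-independent u w hu hw with ∈-pair⁻ hu | ∈-pair⁻ hw
    ... | inj₁ refl | inj₁ refl = adj-irrefl
    ... | inj₁ refl | inj₂ refl = x≁y
    ... | inj₂ refl | inj₁ refl = x≁y ∘′ adj-sym
    ... | inj₂ refl | inj₂ refl = adj-irrefl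

  star-isBiclique : ∀ {x v y} → InducedP₃ x v y
    → (∀ {w} → w ≢ v → Adj G w x → Adj G w y → ¬ Adj G w v → ⊥)
    → (∀ {w} → w ≢ x → w ≢ y → Adj G v w → ¬ Adj G x w → ¬ Adj G y w → ⊥)
    → IsBiclique G (star v x y)
  star-isBiclique {x} {v} {y} p₃@(vx , vy , _ , _) no-rival-centre no-further-leaf =
    star-inducesCompleteBipartite p₃ , maximal
    where
    maximal : ∀ T → star v x y ⊂ T → ¬ InducesCompleteBipartite G T
    maximal T (star⊆T , w , w∈T , w∉star) (A , B , cover , _ , _ , _ , _ , _ , indA , indB , comp) =
      Sum.[ centred A B cover indA indB comp
          , centred B A (λ u → Sum.swap ∘′ cover u) indB indA
                    (λ u u′ hu hu′ → adj-sym (comp u′ u hu′ hu)) ]′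
          (cover v (star⊆T (centre∈star v x y)))
      where
      w≢ : ∀ {u} → u ∈ star v x y → w ≢ u
      w≢ u∈star refl = w∉star u∈star

      x∈T = star⊆T (leaf∈star v x y (x∈pair x y))
      y∈T = star⊆T (leaf∈star v x y (y∈pair x y))

      centred : ∀ X Y → (∀ u → u ∈ T → u ∈ X ⊎ u ∈ Y)
        → (∀ u u′ → u ∈ X → u′ ∈ X → ¬ Adj G u u′)
        → (∀ u u′ → u ∈ Y → u′ ∈ Y → ¬ Adj G u u′)
        → (∀ u u′ → u ∈ X → u′ ∈ Y → Adj G u u′) → v ∈ X → ⊥
      centred X Y cover indX indY comp v∈X with cover x x∈T | cover y y∈T | cover w w∈T
      ... | inj₁ x∈X | _        | _ = indX v x v∈X x∈X vx
      ... | inj₂ _   | inj₁ y∈X | _ = indX v y v∈X y∈X vy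
      ... | inj₂ x∈Y | inj₂ y∈Y | inj₁ w∈X =
        no-rival-centre (w≢ (centre∈star v x y))
          (comp w x w∈X x∈Y) (comp w y w∈X y∈Y) (indX w v w∈X v∈X)
      ... | inj₂ x∈Y | inj₂ y∈Y | inj₂ w∈Y =
        no-further-leaf (w≢ (leaf∈star v x y (x∈pair x y))) (w≢ (leaf∈star v x y (y∈pair x y)))
          (comp v w v∈X w∈Y) (indY x w x∈Y w∈Y) (indY y w y∈Y w∈Y)

  edge-not-maximal : ∀ {S a b c} → (∀ u → u ∈ S → u ≡ a ⊎ u ≡ b) → Adj G a b →
                     PrivateNeighbour c a b → ¬ IsBiclique G S
  edge-not-maximal {S} {a} {b} {c} S⊆ab ab (ac , b≁c , c≢b) (_ , maximal) =
    maximal (star a b c) (S⊆star , c , leaf∈star a b c (y∈pair b c) , c∉S)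
            (star-inducesCompleteBipartite (ab , ac , ≢-sym c≢b , b≁c))
    where
    S⊆star : S ⊆ star a b c
    S⊆star {u} u∈S with S⊆ab u u∈S
    ... | inj₁ refl = centre∈star a b c
    ... | inj₂ refl = leaf∈star a b c (x∈pair b c)

    c∉S : c ∉ S
    c∉S c∈S with S⊆ab c c∈S
    ... | inj₁ refl = adj-irrefl ac
    ... | inj₂ c≡b  = c≢b c≡b

  noMonochromaticInducedP₃⇒isBicliqueColouring :
    ∀ {c} {col : Fin n → Fin c} → EdgesHavePrivateNeighbours →
    NoMonochromaticInducedP₃ col → IsBicliqueColouring G col
  noMonochromaticInducedP₃⇒isBicliqueColouring private-nbr no-P₃ S
    biclique@((A , B , cover , A⊆S , B⊆S , _ , (a , a∈A) , (b , b∈B) , indA , indB , comp) , _)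
    mono with any? (λ a′ → (a′ ∈? A) ×-dec ¬? (a′ ≟ a))
  ... | yes (a′ , a′∈A , a′≢a) =
    no-P₃ (adj-sym (comp a b a∈A b∈B) , adj-sym (comp a′ b a′∈A b∈B) , ≢-sym a′≢a
          , indA a a′ a∈A a′∈A)
          (mono a b (A⊆S a a∈A) (B⊆S b b∈B)) (mono b a′ (B⊆S b b∈B) (A⊆S a′ a′∈A))
  ... | no a-alone with any? (λ b′ → (b′ ∈? B) ×-dec ¬? (b′ ≟ b))
  ...   | yes (b′ , b′∈B , b′≢b) =
    no-P₃ (comp a b a∈A b∈B , comp a b′ a∈A b′∈B , ≢-sym b′≢b , indB b b′ b∈B b′∈B)
          (mono b a (B⊆S b b∈B) (A⊆S a a∈A)) (mono a b′ (A⊆S a a∈A) (B⊆S b′ b′∈B))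
  ...   | no b-alone =
    Sum.[ edge-not-maximal S⊆ab ab , edge-not-maximal (λ u → Sum.swap ∘′ S⊆ab u) (adj-sym ab) ]′
      (proj₂ (private-nbr ab)) biclique
    where
    ab : Adj G a b
    ab = comp a b a∈A b∈B

    S⊆ab : ∀ u → u ∈ S → u ≡ a ⊎ u ≡ b
    S⊆ab u u∈S with cover u u∈S | u ≟ a | u ≟ b
    ... | _        | yes u≡a | _       = inj₁ u≡a
    ... | _        | _       | yes u≡b = inj₂ u≡b
    ... | inj₁ u∈A | no u≢a  | _       = ⊥-elim (a-alone (u , u∈A , u≢a))
    ... | inj₂ u∈B | _       | no u≢b  = ⊥-elim (b-alone (u , u∈B , u≢b))

biclique⇒bicliqueChromaticNumber≡2 : ∀ {n} {G : Graph n} {S} → IsBiclique G S →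
                                     HasBicliqueColouring G 2 → BicliqueChromaticNumber G 2
biclique⇒bicliqueChromaticNumber≡2 {G = G} {S} biclique@((_ , _ , _ , _ , _ , _ , (a , _) , _) , _)
                                   colouring = colouring , fewer
  where
  fewer : ∀ c → c < 2 → ¬ HasBicliqueColouring G c
  fewer 0 _ (col , _) = ¬Fin0 (col a)
  fewer 1 _ (col , isColouring) = isColouring S biclique (λ u w _ _ → all-equal (col u) (col w))
    where
    all-equal : (i j : Fin 1) → i ≡ j
    all-equal Fin.zero Fin.zero = refl
  fewer (suc (suc _)) (s≤s (s≤s ()))

module CycleDistance (n : ℕ) .{{_ : NonZero n}} where

  open ≡-Reasoning

  [a+b%n]%n≡[a+b]%n : ∀ a b → (a + b % n) % n ≡ (a + b) % n
  [a+b%n]%n≡[a+b]%n a b = begin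
    (a + b % n) % n          ≡⟨ %-distribˡ-+ a (b % n) n ⟩
    (a % n + b % n % n) % n  ≡⟨ cong (λ z → (a % n + z) % n) (m%n%n≡m%n b n) ⟩
    (a % n + b % n) % n      ≡⟨ %-distribˡ-+ a b n ⟨
    (a + b) % n              ∎

  [a%n+b]%n≡[a+b]%n : ∀ a b → (a % n + b) % n ≡ (a + b) % n
  [a%n+b]%n≡[a+b]%n a b = begin
    (a % n + b) % n  ≡⟨ cong (_% n) (+-comm (a % n) b) ⟩
    (b + a % n) % n  ≡⟨ [a+b%n]%n≡[a+b]%n b a ⟩
    (b + a) % n      ≡⟨ cong (_% n) (+-comm b a) ⟩
    (a + b) % n      ∎

  -- Adding c * n ∸ c to both sides turns a + c into a + c * n ≡ a (mod n).
  %-cancelʳ-+ : ∀ a b c → (a + c) % n ≡ (b + c) % n → a % n ≡ b % n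
  %-cancelʳ-+ a b c eq = begin
    a % n                  ≡⟨ [m+kn]%n≡m%n a c n ⟨
    (a + c * n) % n        ≡⟨ cong (λ z → (a + z) % n) c+r≡cn ⟨
    (a + (c + r)) % n      ≡⟨ cong (_% n) (+-assoc a c r) ⟨
    (a + c + r) % n        ≡⟨ [a%n+b]%n≡[a+b]%n (a + c) r ⟨
    ((a + c) % n + r) % n  ≡⟨ cong (λ z → (z + r) % n) eq ⟩
    ((b + c) % n + r) % n  ≡⟨ [a%n+b]%n≡[a+b]%n (b + c) r ⟩
    (b + c + r) % n        ≡⟨ cong (_% n) (+-assoc b c r) ⟩
    (b + (c + r)) % n      ≡⟨ cong (λ z → (b + z) % n) c+r≡cn ⟩
    (b + c * n) % n        ≡⟨ [m+kn]%n≡m%n b c n ⟩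
    b % n                  ∎
    where
    r = c * n ∸ c
    c+r≡cn : c + r ≡ c * n
    c+r≡cn = m+[n∸m]≡n (m≤m*n c n)

  -- δ i j is the number of steps forward from v_i to v_j; cycleDist n i j = δ i j ⊓ δ j i.
  δ : Fin n → Fin n → ℕ
  δ i j = (n + toℕ j ∸ toℕ i) % n

  δ<n : ∀ i j → δ i j < n
  δ<n i j = m%n<n _ n

  private
    n+j∸i+i≡n+j : ∀ (i j : Fin n) → n + toℕ j ∸ toℕ i + toℕ i ≡ n + toℕ j
    n+j∸i+i≡n+j i j = m∸n+n≡m (≤-trans (<⇒≤ (toℕ<n i)) (m≤m+n n (toℕ j)))

    [i+n]%n≡i : ∀ (i : Fin n) → (toℕ i + n) % n ≡ toℕ i
    [i+n]%n≡i i = trans ([m+n]%n≡m%n (toℕ i) n) (m<n⇒m%n≡m (toℕ<n i))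

    [n+j]%n≡j : ∀ (j : Fin n) → (n + toℕ j) % n ≡ toℕ j
    [n+j]%n≡j j = trans (cong (_% n) (+-comm n (toℕ j))) ([i+n]%n≡i j)

  δ-reach : ∀ i j → (toℕ i + δ i j) % n ≡ toℕ j
  δ-reach i j = begin
    (toℕ i + δ i j) % n                ≡⟨ [a+b%n]%n≡[a+b]%n (toℕ i) _ ⟩
    (toℕ i + (n + toℕ j ∸ toℕ i)) % n  ≡⟨ cong (_% n) (+-comm (toℕ i) _) ⟩
    (n + toℕ j ∸ toℕ i + toℕ i) % n    ≡⟨ cong (_% n) (n+j∸i+i≡n+j i j) ⟩
    (n + toℕ j) % n                    ≡⟨ [n+j]%n≡j j ⟩
    toℕ j                              ∎

  δ-reach-+ : ∀ i j t → (toℕ i + δ i j + t) % n ≡ (toℕ j + t) % n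
  δ-reach-+ i j t = begin
    (toℕ i + δ i j + t) % n        ≡⟨ [a%n+b]%n≡[a+b]%n (toℕ i + δ i j) t ⟨
    ((toℕ i + δ i j) % n + t) % n  ≡⟨ cong (λ z → (z + t) % n) (δ-reach i j) ⟩
    (toℕ j + t) % n                ∎

  δ-unique : ∀ i j t → (toℕ i + t) % n ≡ toℕ j → δ i j ≡ t % n
  δ-unique i j t eq = %-cancelʳ-+ _ t (toℕ i) (begin
    (n + toℕ j ∸ toℕ i + toℕ i) % n  ≡⟨ cong (_% n) (n+j∸i+i≡n+j i j) ⟩
    (n + toℕ j) % n                  ≡⟨ [n+j]%n≡j j ⟩
    toℕ j                            ≡⟨ eq ⟨
    (toℕ i + t) % n                  ≡⟨ cong (_% n) (+-comm (toℕ i) t) ⟩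
    (t + toℕ i) % n                  ∎)

  δ-unique-< : ∀ i j t → t < n → (toℕ i + t) % n ≡ toℕ j → δ i j ≡ t
  δ-unique-< i j t t<n eq = trans (δ-unique i j t eq) (m<n⇒m%n≡m t<n)

  δ-self : ∀ i → δ i i ≡ 0
  δ-self i = trans (cong (_% n) (m+n∸n≡m n (toℕ i))) (n%n≡0 n)

  δ≡nonZero⇒≢ : ∀ {i j r} → δ i j ≡ r → .{{NonZero r}} → i ≢ j
  δ≡nonZero⇒≢ {i} {r = r} δ≡r refl = ≢-nonZero⁻¹ r (trans (sym δ≡r) (δ-self i))

  ≢⇒δ≢0 : ∀ {i j} → i ≢ j → δ i j ≢ 0
  ≢⇒δ≢0 {i} {j} i≢j δ≡0 = i≢j (toℕ-injective (begin
    toℕ i                ≡⟨ m<n⇒m%n≡m (toℕ<n i) ⟨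
    toℕ i % n            ≡⟨ cong (_% n) (+-identityʳ (toℕ i)) ⟨
    (toℕ i + 0) % n      ≡⟨ cong (λ z → (toℕ i + z) % n) δ≡0 ⟨
    (toℕ i + δ i j) % n  ≡⟨ δ-reach i j ⟩
    toℕ j                ∎))

  δ-sum : ∀ i v j → δ i j ≡ (δ i v + δ v j) % n
  δ-sum i v j = δ-unique i j _ (begin
    (toℕ i + (δ i v + δ v j)) % n  ≡⟨ cong (_% n) (+-assoc (toℕ i) _ _) ⟨
    (toℕ i + δ i v + δ v j) % n    ≡⟨ δ-reach-+ i v (δ v j) ⟩
    (toℕ v + δ v j) % n            ≡⟨ δ-reach v j ⟩
    toℕ j                          ∎)

  δ-triangle : ∀ i v j → δ i j ≤ δ i v + δ v j
  δ-triangle i v j = ≤-trans (≤-reflexive (δ-sum i v j)) (m%n≤m _ n)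

  δ-flip : ∀ {i j} → i ≢ j → δ j i ≡ n ∸ δ i j
  δ-flip {i} {j} i≢j =
    δ-unique-< j i (n ∸ d) (∸-monoʳ-< (n≢0⇒n>0 (≢⇒δ≢0 i≢j)) (<⇒≤ (δ<n i j))) (begin
      (toℕ j + (n ∸ d)) % n        ≡⟨ δ-reach-+ i j (n ∸ d) ⟨
      (toℕ i + d + (n ∸ d)) % n    ≡⟨ cong (_% n) (+-assoc (toℕ i) d _) ⟩
      (toℕ i + (d + (n ∸ d))) % n  ≡⟨ cong (λ z → (toℕ i + z) % n) (m+[n∸m]≡n (<⇒≤ (δ<n i j))) ⟩
      (toℕ i + n) % n              ≡⟨ [i+n]%n≡i i ⟩
      toℕ i                        ∎)
    where d = δ i j

  δ-ahead : ∀ v x y → δ v x ≤ δ v y → δ x y ≡ δ v y ∸ δ v x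
  δ-ahead v x y le = δ-unique-< x y d (≤-<-trans (m∸n≤m (δ v y) (δ v x)) (δ<n v y)) (begin
    (toℕ x + d) % n              ≡⟨ δ-reach-+ v x d ⟨
    (toℕ v + δ v x + d) % n      ≡⟨ cong (_% n) (+-assoc (toℕ v) _ d) ⟩
    (toℕ v + (δ v x + d)) % n    ≡⟨ cong (λ z → (toℕ v + z) % n) (m+[n∸m]≡n le) ⟩
    (toℕ v + δ v y) % n          ≡⟨ δ-reach v y ⟩
    toℕ y                        ∎)
    where d = δ v y ∸ δ v x

  δ-behind : ∀ v x y → δ x v ≤ δ y v → δ y x ≡ δ y v ∸ δ x v
  δ-behind v x y le = δ-unique-< y x d (≤-<-trans (m∸n≤m (δ y v) (δ x v)) (δ<n y v))
    (trans (%-cancelʳ-+ (toℕ y + d) (toℕ x) (δ x v) (begin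
      (toℕ y + d + δ x v) % n    ≡⟨ cong (_% n) (+-assoc (toℕ y) d _) ⟩
      (toℕ y + (d + δ x v)) % n  ≡⟨ cong (λ z → (toℕ y + z) % n) (m∸n+n≡m le) ⟩
      (toℕ y + δ y v) % n        ≡⟨ δ-reach y v ⟩
      toℕ v                      ≡⟨ δ-reach x v ⟨
      (toℕ x + δ x v) % n        ∎))
      (m<n⇒m%n≡m (toℕ<n x)))
    where d = δ y v ∸ δ x v

  vertex : ℕ → Fin n
  vertex t = t mod n

  toℕ-vertex : ∀ t → toℕ (vertex t) ≡ t % n
  toℕ-vertex t = toℕ-fromℕ< (m%n<n t n)

  δ-vertex : ∀ i {t} → t < n → δ i (vertex (toℕ i + t)) ≡ t
  δ-vertex i {t} t<n = δ-unique-< i _ t t<n (sym (toℕ-vertex (toℕ i + t)))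

  δ-vertex-vertex : ∀ {s t} → s ≤ t → t < n → δ (vertex s) (vertex t) ≡ t ∸ s
  δ-vertex-vertex {s} {t} s≤t t<n =
    δ-unique-< (vertex s) (vertex t) (t ∸ s) (≤-<-trans (m∸n≤m t s) t<n) (begin
      (toℕ (vertex s) + (t ∸ s)) % n  ≡⟨ cong (λ z → (z + (t ∸ s)) % n) (toℕ-vertex s) ⟩
      (s % n + (t ∸ s)) % n           ≡⟨ [a%n+b]%n≡[a+b]%n s (t ∸ s) ⟩
      (s + (t ∸ s)) % n               ≡⟨ cong (_% n) (m+[n∸m]≡n s≤t) ⟩
      t % n                           ≡⟨ toℕ-vertex t ⟨
      toℕ (vertex t)                  ∎)

module CyclePowerAdjacency (n : ℕ) .{{_ : NonZero n}} (k : ℕ) where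

  open CycleDistance n

  infix 4 _~_
  _~_ : Fin n → Fin n → Set
  _~_ = Adj (CyclePower n k)

  ~-irrefl : ∀ {i} → ¬ i ~ i
  ~-irrefl (i≢i , _) = i≢i refl

  ~-sym : ∀ {i j} → i ~ j → j ~ i
  ~-sym {i} {j} (i≢j , le) = ≢-sym i≢j , subst (_≤ k) (⊓-comm (δ i j) (δ j i)) le

  _~?_ : ∀ i j → Dec (i ~ j)
  i ~? j = ¬? (i ≟ j) ×-dec (cycleDist n i j ≤? k)

  ~⇒δ≤ : ∀ {i j} → i ~ j → δ i j ≤ k ⊎ δ j i ≤ k
  ~⇒δ≤ {i} {j} (_ , le) = Sum.map (λ eq → subst (_≤ k) eq le) (λ eq → subst (_≤ k) eq le)
                                  (⊓-sel (δ i j) (δ j i))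

  δ≤⇒~ : ∀ {i j} → i ≢ j → δ i j ≤ k → i ~ j
  δ≤⇒~ {i} {j} i≢j le = i≢j , ≤-trans (m⊓n≤m (δ i j) (δ j i)) le

  ≁⇒k<δ : ∀ {i j} → i ≢ j → ¬ i ~ j → k < δ i j
  ≁⇒k<δ i≢j i≁j = ≰⇒> (i≁j ∘′ δ≤⇒~ i≢j)

  private
    ∸-≤ : ∀ {a d} b → a ≤ k → d ≡ a ∸ b → d ≤ k
    ∸-≤ {a} b a≤k refl = ≤-trans (m∸n≤m a b) a≤k

  ahead⇒~ : ∀ v {x y} → δ v x ≤ k → δ v y ≤ k → x ≢ y → x ~ y
  ahead⇒~ v {x} {y} vx vy x≢y with ≤-total (δ v x) (δ v y)
  ... | inj₁ le = δ≤⇒~ x≢y (∸-≤ (δ v x) vy (δ-ahead v x y le))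
  ... | inj₂ le = ~-sym (δ≤⇒~ (≢-sym x≢y) (∸-≤ (δ v y) vx (δ-ahead v y x le)))

  behind⇒~ : ∀ v {x y} → δ x v ≤ k → δ y v ≤ k → x ≢ y → x ~ y
  behind⇒~ v {x} {y} xv yv x≢y with ≤-total (δ x v) (δ y v)
  ... | inj₁ le = ~-sym (δ≤⇒~ (≢-sym x≢y) (∸-≤ (δ x v) yv (δ-behind v x y le)))
  ... | inj₂ le = δ≤⇒~ x≢y (∸-≤ (δ y v) xv (δ-behind v y x le))

  far⇒≁ : ∀ {i j} → k < δ i j → δ i j + k < n → ¬ i ~ j
  far⇒≁ {i} {j} k<δij δij+k<n i~j with ~⇒δ≤ i~j
  ... | inj₁ le = <⇒≱ k<δij le
  ... | inj₂ le = <⇒≱ δij+k<n (begin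
    n                    ≡⟨ m+[n∸m]≡n (<⇒≤ (δ<n i j)) ⟨
    δ i j + (n ∸ δ i j)  ≡⟨ cong (δ i j +_) (δ-flip (proj₁ i~j)) ⟨
    δ i j + δ j i        ≤⟨ +-monoʳ-≤ (δ i j) le ⟩
    δ i j + k            ∎)
    where open ≤-Reasoning

  open Bicliques (CyclePower n k) ~-sym ~-irrefl

  module _ (2k+1<n : suc (k + k) < n) where

    private
      1+k<n : suc k < n
      1+k<n = ≤-trans (s≤s (s≤s (m≤m+n k k))) 2k+1<n

    -- c is the vertex k + 1 steps ahead of a: out of a's reach, but at most k steps past b.
    private-neighbour-ahead : ∀ {a b} → a ≢ b → δ a b ≤ k → ∃[ c ] PrivateNeighbour c b a
    private-neighbour-ahead {a} {b} a≢b d≤k =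
      c , δ≤⇒~ (δ≡nonZero⇒≢ δbc) (≤-trans (≤-reflexive δbc) e≤k)
        , far⇒≁ (≤-reflexive (sym δac)) (subst (λ z → z + k < n) (sym δac) 2k+1<n)
        , ≢-sym (δ≡nonZero⇒≢ δac)
      where
      d = δ a b
      e = suc (k ∸ d)
      c = vertex (toℕ b + e)

      e≤k : e ≤ k
      e≤k = ∸-monoʳ-< (n≢0⇒n>0 (≢⇒δ≢0 a≢b)) d≤k

      δbc : δ b c ≡ e
      δbc = δ-vertex b (≤-trans (s≤s e≤k) (<⇒≤ 1+k<n))

      δac : δ a c ≡ suc k
      δac = begin
        δ a c            ≡⟨ δ-sum a b c ⟩
        (d + δ b c) % n  ≡⟨ cong (λ z → (d + z) % n) δbc ⟩
        (d + e) % n      ≡⟨ cong (_% n) (trans (+-suc d (k ∸ d)) (cong suc (m+[n∸m]≡n d≤k))) ⟩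
        suc k % n        ≡⟨ m<n⇒m%n≡m 1+k<n ⟩
        suc k            ∎
        where open ≡-Reasoning

    edgesHavePrivateNeighbours : EdgesHavePrivateNeighbours
    edgesHavePrivateNeighbours a~b with ~⇒δ≤ a~b
    ... | inj₁ le = map₂ inj₂ (private-neighbour-ahead (proj₁ a~b) le)
    ... | inj₂ le = map₂ inj₁ (private-neighbour-ahead (≢-sym (proj₁ a~b)) le)

parity-≡⇒≡ : ∀ {x y} → x ≤ y → y ≤ suc x → parity x ≡ parity y → x ≡ y
parity-≡⇒≡ {x} x≤y y≤1+x px≡py with m≤n⇒m<n∨m≡n y≤1+x
... | inj₁ y<1+x = ≤-antisym x≤y (s≤s⁻¹ y<1+x)
... | inj₂ refl  =
  ⊥-elim (ℙ.p≢p⁻¹ (parity (suc x)) (trans (sym px≡py) (sym (ℙ.suc-homo-⁻¹ x))))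

parity-+-even : ∀ x y → parity (x + 2 * y) ≡ parity x
parity-+-even x y = begin
  parity (x + 2 * y)           ≡⟨ ℙ.+-homo-+ x (2 * y) ⟩
  parity x ℙ.+ parity (2 * y)  ≡⟨ cong (parity x ℙ.+_) (ℙ.*-homo-* 2 y) ⟩
  parity x ℙ.+ 0ℙ              ≡⟨ ℙ.+-identityʳ (parity x) ⟩
  parity x                     ∎
  where open ≡-Reasoning

module SlowStepParity (f : ℕ → ℕ) (k : ℕ)
  (f-mono : ∀ {s t} → s ≤ t → f s ≤ f t)
  (f-slow : ∀ t d → d ≤ k → f (t + d) ≤ suc (f t))
  (f-fast : ∀ t → suc (f t) ≤ f (t + suc k)) where

  parity-hop : ∀ t {a b} → a ≤ k → b ≤ k → k < a + b →
               parity (f t) ≡ parity (f (t + a)) →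
               parity (f (t + a)) ≡ parity (f (t + a + b)) → ⊥
  parity-hop t {a} {b} a≤k b≤k k<a+b eq₁ eq₂ = <⇒≱ (f-fast t) (begin
    f (t + suc k)  ≤⟨ f-mono (≤-trans (+-monoʳ-≤ t k<a+b) (≤-reflexive (sym (+-assoc t a b)))) ⟩
    f (t + a + b)  ≡⟨ unmoved (t + a) b≤k eq₂ ⟨
    f (t + a)      ≡⟨ unmoved t a≤k eq₁ ⟨
    f t            ∎)
    where
    open ≤-Reasoning
    unmoved : ∀ s {d} → d ≤ k → parity (f s) ≡ parity (f (s + d)) → f s ≡ f (s + d)
    unmoved s {d} d≤k = parity-≡⇒≡ (f-mono (m≤m+n s d)) (f-slow s d d≤k)

parityFin : Parity → Fin 2
parityFin 0ℙ = Fin.zero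
parityFin 1ℙ = Fin.suc Fin.zero

parityFin-injective : ∀ {p q} → parityFin p ≡ parityFin q → p ≡ q
parityFin-injective {0ℙ} {0ℙ} _ = refl
parityFin-injective {1ℙ} {1ℙ} _ = refl

module BlockColouring (n : ℕ) .{{_ : NonZero n}} (k : ℕ) .{{_ : NonZero k}}
                      (2k²≤n : 2 * (k * k) ≤ n) where

  open CycleDistance n
  open CyclePowerAdjacency n k
  open Bicliques (CyclePower n k) ~-sym ~-irrefl

  instance
    2k≢0 : NonZero (2 * k)
    2k≢0 = m*n≢0 2 k

  q m : ℕ
  q = n / (2 * k)
  m = 2 * q

  private
    swap-factors : ∀ a b → a * (2 * b) ≡ b * (2 * a)
    swap-factors = solve-∀

    double-square : ∀ a → a * (2 * a) ≡ 2 * (a * a)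
    double-square = solve-∀

    times-double : ∀ a b → a * (2 * b) ≡ 2 * (a * b)
    times-double = solve-∀

    distrib : ∀ t c m n → (t + c * n) * m ≡ t * m + c * m * n
    distrib = solve-∀

  km≤n : k * m ≤ n
  km≤n = subst (_≤ n) (swap-factors q k) (m/n*n≤m n (2 * k))

  k≤q : k ≤ q
  k≤q = subst (_≤ q) (m*n/n≡m k (2 * k))
              (/-monoˡ-≤ (2 * k) (subst (_≤ n) (sym (double-square k)) 2k²≤n))

  n≤[1+k]m : n ≤ suc k * m
  n≤[1+k]m = begin
    n                          ≡⟨ m≡m%n+[m/n]*n n (2 * k) ⟩
    n % (2 * k) + q * (2 * k)  ≤⟨ +-monoˡ-≤ (q * (2 * k)) n%2k≤m ⟩
    m + q * (2 * k)            ≡⟨ cong (m +_) (swap-factors k q) ⟨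
    m + k * m                  ∎
    where
    open ≤-Reasoning
    n%2k≤m : n % (2 * k) ≤ m
    n%2k≤m = ≤-trans (<⇒≤ (m%n<n n (2 * k))) (*-monoʳ-≤ 2 k≤q)

  block : ℕ → ℕ
  block t = t * m / n

  block-mono : ∀ {s t} → s ≤ t → block s ≤ block t
  block-mono s≤t = /-monoˡ-≤ n (*-monoˡ-≤ m s≤t)

  [a+n]/n≡1+a/n : ∀ a → (a + n) / n ≡ suc (a / n)
  [a+n]/n≡1+a/n a = trans (m/n≡1+[m∸n]/n (m≤n+m n a)) (cong (λ z → suc (z / n)) (m+n∸n≡m a n))

  block-slow : ∀ t d → d ≤ k → block (t + d) ≤ suc (block t)
  block-slow t d d≤k = subst (block (t + d) ≤_) ([a+n]/n≡1+a/n (t * m)) (/-monoˡ-≤ n (begin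
    (t + d) * m    ≡⟨ *-distribʳ-+ m t d ⟩
    t * m + d * m  ≤⟨ +-monoʳ-≤ (t * m) (≤-trans (*-monoˡ-≤ m d≤k) km≤n) ⟩
    t * m + n      ∎))
    where open ≤-Reasoning

  block-fast : ∀ t → suc (block t) ≤ block (t + suc k)
  block-fast t = subst (_≤ block (t + suc k)) ([a+n]/n≡1+a/n (t * m)) (/-monoˡ-≤ n (begin
    t * m + n          ≤⟨ +-monoʳ-≤ (t * m) n≤[1+k]m ⟩
    t * m + suc k * m  ≡⟨ *-distribʳ-+ m t (suc k) ⟨
    (t + suc k) * m    ∎))
    where open ≤-Reasoning

  block-periodic : ∀ t c → block (t + c * n) ≡ block t + c * m
  block-periodic t c = begin
    (t + c * n) * m / n      ≡⟨ cong (_/ n) (distrib t c m n) ⟩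
    (t * m + c * m * n) / n  ≡⟨ +-distrib-/-∣ʳ (t * m) (divides (c * m) refl) ⟩
    block t + c * m * n / n  ≡⟨ cong (block t +_) (m*n/n≡m (c * m) n) ⟩
    block t + c * m          ∎
    where open ≡-Reasoning

  parity-block-% : ∀ t → parity (block (t % n)) ≡ parity (block t)
  parity-block-% t = begin
    parity r                      ≡⟨ parity-+-even r (t / n * q) ⟨
    parity (r + 2 * (t / n * q))  ≡⟨ cong (λ z → parity (r + z)) (times-double (t / n) q) ⟨
    parity (r + t / n * m)        ≡⟨ cong parity (block-periodic (t % n) (t / n)) ⟨
    parity (block t′)             ≡⟨ cong (λ z → parity (block z)) (m≡m%n+[m/n]*n t n) ⟨
    parity (block t)              ∎
    where
    open ≡-Reasoning
    r = block (t % n)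
    t′ = t % n + t / n * n

  colour : Fin n → Fin 2
  colour i = parityFin (parity (block (toℕ i)))

  open SlowStepParity block k block-mono block-slow block-fast

  hop-not-monochromatic : ∀ x v y → δ x v ≤ k → δ v y ≤ k → k < δ x y →
                          colour x ≡ colour v → colour v ≡ colour y → ⊥
  hop-not-monochromatic x v y xv vy k<xy xv-same vy-same =
    parity-hop (toℕ x) xv vy (<-≤-trans k<xy (δ-triangle x v y))
      (trans (parityFin-injective xv-same) (sym at-v))
      (trans at-v (trans (parityFin-injective vy-same) (sym at-y)))
    where
    represents : ∀ {s} (i : Fin n) → s % n ≡ toℕ i → parity (block s) ≡ parity (block (toℕ i))
    represents {s} i eq = trans (sym (parity-block-% s)) (cong (λ z → parity (block z)) eq)

    at-v : parity (block (toℕ x + δ x v)) ≡ parity (block (toℕ v))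
    at-v = represents v (δ-reach x v)

    at-y : parity (block (toℕ x + δ x v + δ v y)) ≡ parity (block (toℕ y))
    at-y = represents y (trans (δ-reach-+ x v (δ v y)) (δ-reach v y))

  colour-noMonochromaticInducedP₃ : NoMonochromaticInducedP₃ colour
  colour-noMonochromaticInducedP₃ {x} {v} {y} (v~x , v~y , x≢y , x≁y) xv-same vy-same
    with ~⇒δ≤ v~x | ~⇒δ≤ v~y
  ... | inj₁ vx | inj₁ vy = x≁y (ahead⇒~ v vx vy x≢y)
  ... | inj₂ xv | inj₂ yv = x≁y (behind⇒~ v xv yv x≢y)
  ... | inj₂ xv | inj₁ vy = hop-not-monochromatic x v y xv vy (≁⇒k<δ x≢y x≁y) xv-same vy-same
  ... | inj₁ vx | inj₂ yv =
    hop-not-monochromatic y v x yv vx (≁⇒k<δ (≢-sym x≢y) (x≁y ∘′ ~-sym)) (sym vy-same) (sym xv-same)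

  colour-isBicliqueColouring : suc (k + k) < n → IsBicliqueColouring (CyclePower n k) colour
  colour-isBicliqueColouring 2k+1<n =
    noMonochromaticInducedP₃⇒isBicliqueColouring (edgesHavePrivateNeighbours 2k+1<n)
                                                  colour-noMonochromaticInducedP₃

module CyclePowerStar (n : ℕ) .{{_ : NonZero n}} (k : ℕ) .{{_ : NonZero k}}
                      (3k+2≤n : suc (k + k) + suc k ≤ n) where

  open CycleDistance n
  open CyclePowerAdjacency n k
  open Bicliques (CyclePower n k) ~-sym ~-irrefl

  private
    2k+1<n : suc (k + k) < n
    2k+1<n = <-≤-trans (m<m+n (suc (k + k)) z<s) 3k+2≤n

    1+k<n : suc k < n
    1+k<n = ≤-<-trans (s≤s (m≤m+n k k)) 2k+1<n

    x v y : Fin n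
    x = vertex 0
    v = vertex 1
    y = vertex (suc k)

    δxv : δ x v ≡ 1
    δxv = δ-vertex-vertex z≤n (≤-<-trans (s≤s z≤n) 1+k<n)

    δvy : δ v y ≡ k
    δvy = δ-vertex-vertex (s≤s z≤n) 1+k<n

    δxy : δ x y ≡ suc k
    δxy = δ-vertex-vertex z≤n 1+k<n

    δxv≤k : δ x v ≤ k
    δxv≤k = subst (_≤ k) (sym δxv) (>-nonZero⁻¹ k)

    x≢y : x ≢ y
    x≢y = δ≡nonZero⇒≢ δxy

    x≁y : ¬ x ~ y
    x≁y = far⇒≁ (≤-reflexive (sym δxy)) (subst (λ z → z + k < n) (sym δxy) 2k+1<n)

    2k<δyx : k + k < δ y x
    2k<δyx = subst (k + k <_) (sym (trans (δ-flip x≢y) (cong (n ∸_) δxy)))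
                   (m+n≤o⇒m≤o∸n (suc (k + k)) 3k+2≤n)

    p₃ : InducedP₃ x v y
    p₃ = ~-sym (δ≤⇒~ (δ≡nonZero⇒≢ δxv) δxv≤k) , δ≤⇒~ (δ≡nonZero⇒≢ δvy) (≤-reflexive δvy)
       , x≢y , x≁y

    -- A common neighbour w of x and y lies behind y (then it sees v), or ahead of both x
    -- and y (then x ~ y), or between y and x; but x is n − k − 1 > 2k steps after y.
    no-rival-centre : ∀ {w} → w ≢ v → w ~ x → w ~ y → ¬ w ~ v → ⊥
    no-rival-centre {w} w≢v w~x w~y w≁v with ~⇒δ≤ w~y
    ... | inj₁ wy = w≁v (behind⇒~ y wy (≤-reflexive δvy) w≢v)
    ... | inj₂ yw with ~⇒δ≤ w~x
    ...   | inj₂ xw = x≁y (behind⇒~ w xw yw x≢y)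
    ...   | inj₁ wx = <⇒≱ 2k<δyx (≤-trans (δ-triangle y w x) (+-mono-≤ yw wx))

    no-further-leaf : ∀ {w} → w ≢ x → w ≢ y → v ~ w → ¬ x ~ w → ¬ y ~ w → ⊥
    no-further-leaf w≢x w≢y v~w x≁w y≁w with ~⇒δ≤ v~w
    ... | inj₁ vw = y≁w (ahead⇒~ v (≤-reflexive δvy) vw (≢-sym w≢y))
    ... | inj₂ wv = x≁w (behind⇒~ v δxv≤k wv (≢-sym w≢x))

  isBiclique : IsBiclique (CyclePower n k) (star (vertex 1) (vertex 0) (vertex (suc k)))
  isBiclique = star-isBiclique p₃ no-rival-centre no-further-leaf

C₄-isBiclique : IsBiclique (CyclePower 4 1) ⊤
C₄-isBiclique =
  ( evens , odds , from-yes (all? λ u → (u ∈? ⊤) →-dec ((u ∈? evens) ⊎-dec (u ∈? odds)))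
  , (λ _ _ → ∈⊤) , (λ _ _ → ∈⊤) , from-yes (all? λ u → (u ∈? evens) →-dec ¬? (u ∈? odds))
  , (Fin.zero , from-yes (Fin.zero ∈? evens))
  , (Fin.suc Fin.zero , from-yes (Fin.suc Fin.zero ∈? odds))
  , from-yes (all? λ u → all? λ w → (u ∈? evens) →-dec (w ∈? evens) →-dec ¬? (u ~? w))
  , from-yes (all? λ u → all? λ w → (u ∈? odds) →-dec (w ∈? odds) →-dec ¬? (u ~? w))
  , from-yes (all? λ u → all? λ w → (u ∈? evens) →-dec (w ∈? odds) →-dec (u ~? w)) )
  , λ _ (_ , _ , _ , w∉⊤) _ → w∉⊤ ∈⊤
  where
  open CyclePowerAdjacency 4 1

  evens odds : Subset 4
  evens = inside ∷ outside ∷ inside ∷ outside ∷ []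
  odds  = outside ∷ inside ∷ outside ∷ inside ∷ []

-- For k ≥ 2 the bound 2k² ≤ n already gives 3k + 2 ≤ n; for k = 1 only n = 4 is left out.
cyclePower-hasBiclique : ∀ n .{{_ : NonZero n}} k → 1 ≤ k → 2 * k + 2 ≤ n → 2 * (k * k) ≤ n →
                         ∃[ S ] IsBiclique (CyclePower n k) S
cyclePower-hasBiclique n (suc zero) _ 4≤n _ with n ℕ.≟ 4
... | yes refl = ⊤ , C₄-isBiclique
... | no n≢4   = _ , CyclePowerStar.isBiclique n 1 (≤∧≢⇒< 4≤n (n≢4 ∘′ sym))
cyclePower-hasBiclique n k@(suc (suc j)) _ _ 2k²≤n =
  _ , CyclePowerStar.isBiclique n k
        (≤-trans (m≤m+n _ (2 * (j * j) + 5 * j)) (≤-trans (≤-reflexive (expand j)) 2k²≤n))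
  where
  expand : ∀ j → suc (suc (suc j) + suc (suc j)) + suc (suc (suc j)) + (2 * (j * j) + 5 * j)
                 ≡ 2 * (suc (suc j) * suc (suc j))
  expand = solve-∀

corollary2 : (k n : ℕ) → 1 ≤ k → 2 * k + 2 ≤ n → 2 * (k * k) ≤ n →
    .{{_ : NonZero n}} → BicliqueChromaticNumber (CyclePower n k) 2
corollary2 k n 1≤k 2k+2≤n 2k²≤n =
  biclique⇒bicliqueChromaticNumber≡2 (proj₂ (cyclePower-hasBiclique n k 1≤k 2k+2≤n 2k²≤n))
    (colour , colour-isBicliqueColouring (subst (_≤ n) (double-plus-two k) 2k+2≤n))
  where
  instance
    k≢0 : NonZero k
    k≢0 = >-nonZero 1≤k

  open BlockColouring n k 2k²≤n

  double-plus-two : ∀ k → 2 * k + 2 ≡ suc (suc (k + k))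
  double-plus-two = solve-∀
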